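{- Let $m\ge1,n\ge0$, identify $a_i=s_i$ for $i=1,\dots,m$ so that $S=A\cup\{s_0\}$. For $(R,T)\in\mathfrak{A\!C}_{m,n}^{\bullet}$ define $R_o\subseteq S\times C$ and $T_o\subseteq C\times S$ by \[ R_o=R\cup\{(s_0,c_j): \text{there is } i\in\{1,\dots,m\}\text{ with } (a_i,c_j)\in R\},\qquad T_o=T. \] Then $(R_o,T_o)\in\mathfrak{S\!C}_{m,n}^{\bullet}$.
   Context: For posets $(P,\le_P)$, $(Q,\le_Q)$ on disjoint ground sets and $R\subseteq P\times Q$, $T\subseteq Q\times P$, define $\le_{R,T}$ on $P\cup Q$ by: $x\le_{R,T}y$ iff $x\le_P y$, or $x\le_Q y$, or $(x,y)\in R$, or $(x,y)\in T$. $(R,T)$ is a merging if $\le_{R,T}$ is reflexive and transitive, and a proper merging if moreover $R\cap T^{ -1}=\emptyset$. The $m$-star is the poset on $S=\{s_0,\dots,s_m\}$ with $s\le s'$ iff $s=s'$ or $s=s_0$; the $m$-antichain is the poset on $A=\{a_1,\dots,a_m\}$ with only trivial relations; the $n$-chain is the poset on $C=\{c_1,\dots,c_n\}$ with $c_i\le c_j$ iff $i\le j$. $\mathfrak{S\!C}_{m,n}^{\bullet}$ is the set of proper mergings of the $m$-star and the $n$-chain, and $\mathfrak{A\!C}_{m,n}^{\bullet}$ the set of proper mergings of the $m$-antichain and the $n$-chain. -}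

module Defs where

open import Data.Nat using (ℕ; suc)
open import Data.Fin using (Fin; zero; suc)
import Data.Fin as Fin
open import Data.Sum using (_⊎_; inj₁; inj₂)
open import Data.Product using (_×_; ∃; _,_)
open import Data.Empty using (⊥)
open import Level using (0ℓ)
open import Relation.Binary.Core using (Rel; REL)
open import Relation.Binary.Definitions using (Reflexive; Transitive)
open import Relation.Binary.PropositionalEquality using (_≡_)

merged : {X Y : Set} → Rel X 0ℓ → Rel Y 0ℓ → REL X Y 0ℓ → REL Y X 0ℓ → Rel (X ⊎ Y) 0ℓ
merged ≤P ≤Q R T (inj₁ x) (inj₁ x') = ≤P x x'
merged ≤P ≤Q R T (inj₂ y) (inj₂ y') = ≤Q y y'
merged ≤P ≤Q R T (inj₁ x) (inj₂ y)  = R x y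
merged ≤P ≤Q R T (inj₂ y) (inj₁ x)  = T y x

IsMerging : {X Y : Set} → Rel X 0ℓ → Rel Y 0ℓ → REL X Y 0ℓ → REL Y X 0ℓ → Set
IsMerging ≤P ≤Q R T = Reflexive (merged ≤P ≤Q R T) × Transitive (merged ≤P ≤Q R T)

IsProperMerging : {X Y : Set} → Rel X 0ℓ → Rel Y 0ℓ → REL X Y 0ℓ → REL Y X 0ℓ → Set
IsProperMerging ≤P ≤Q R T =
  IsMerging ≤P ≤Q R T × (∀ x y → R x y → T y x → ⊥)

-- m-star on S = {s_0,...,s_m} encoded as Fin (suc m), s_0 = zero, s_i = suc (i-1).
starOrder : (m : ℕ) → Rel (Fin (suc m)) 0ℓ
starOrder m s s' = (s ≡ s') ⊎ (s ≡ zero)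

-- m-antichain on A = {a_1,...,a_m} encoded as Fin m (a_i = index i-1).
antichainOrder : (m : ℕ) → Rel (Fin m) 0ℓ
antichainOrder m a a' = a ≡ a'

chainOrder : (n : ℕ) → Rel (Fin n) 0ℓ
chainOrder n = Fin._≤_

IsAC• : (m n : ℕ) → REL (Fin m) (Fin n) 0ℓ → REL (Fin n) (Fin m) 0ℓ → Set
IsAC• m n R T = IsProperMerging (antichainOrder m) (chainOrder n) R T

IsSC• : (m n : ℕ) → REL (Fin (suc m)) (Fin n) 0ℓ → REL (Fin n) (Fin (suc m)) 0ℓ → Set
IsSC• m n R T = IsProperMerging (starOrder m) (chainOrder n) R T

-- Identification a_i = s_i: a_i (index i : Fin m) ↦ suc i in Fin (suc m).
-- R_o = R ∪ {(s_0,c_j) : ∃ i, (a_i,c_j) ∈ R}.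
Ro : (m n : ℕ) → REL (Fin m) (Fin n) 0ℓ → REL (Fin (suc m)) (Fin n) 0ℓ
Ro m n R zero    c = ∃ λ (i : Fin m) → R i c
Ro m n R (suc a) c = R a c

-- T_o = T (transported along the identification a_i = s_i);
-- s_0 is not related to anything via T_o.
To : (m n : ℕ) → REL (Fin n) (Fin m) 0ℓ → REL (Fin n) (Fin (suc m)) 0ℓ
To m n T c zero    = ⊥
To m n T c (suc a) = T c a

module Submission where

-- Write N for the merged order ≤_{R,T} on A ∪ C and M for the
-- merged order ≤_{R_o,T_o} on S ∪ C, and let ι : A ∪ C → S ∪ C be the
-- identification a_i ↦ s_i.  The argument never uses that C is a chain, so
-- it is carried out for an arbitrary relation on C.
--   * ι is an order embedding: N x y holds iff M (ι x) (ι y) holds.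
--   * Nothing lies strictly below s₀: no ι x satisfies M (ι x) s₀.
--   * Everything M-above something above s₀ is itself above s₀, because
--     s₀ lies below every s_i and R_o puts s₀ below exactly the elements of C
--     lying above some a_i.
-- Transitivity of M then follows by a view that splits each point of S ∪ C
-- into s₀ or a lifted point ι x: a chain starting at s₀ is handled by the
-- third fact, a chain through s₀ otherwise is impossible by the second, and
-- a chain of lifted points is reflected to N, composed there, and embedded
-- back.  Reflexivity and properness are immediate since T_o never reaches s₀.

open import Defs
open import Data.Nat using (ℕ; _≤_) renaming (suc to 1+)
open import Data.Fin using (Fin; zero; suc)
open import Data.Fin.Properties using (suc-injective)
open import Data.Sum using (_⊎_; inj₁; inj₂)
open import Data.Product using (_,_)
open import Data.Empty using (⊥; ⊥-elim)
open import Level using (0ℓ)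
open import Relation.Binary.Core using (Rel; REL)
open import Relation.Binary.Definitions using (Reflexive; Transitive)
open import Relation.Binary.PropositionalEquality using (_≡_; refl; cong)

module Coning {m n : ℕ} (≤C : Rel (Fin n) 0ℓ)
               (R : REL (Fin m) (Fin n) 0ℓ) (T : REL (Fin n) (Fin m) 0ℓ) where

  N : Rel (Fin m ⊎ Fin n) 0ℓ
  N = merged (antichainOrder m) ≤C R T

  M : Rel (Fin (1+ m) ⊎ Fin n) 0ℓ
  M = merged (starOrder m) ≤C (Ro m n R) (To m n T)

  ι : Fin m ⊎ Fin n → Fin (1+ m) ⊎ Fin n
  ι (inj₁ a) = inj₁ (suc a)
  ι (inj₂ c) = inj₂ c

  s₀ : Fin (1+ m) ⊎ Fin n
  s₀ = inj₁ zero

  data View : Fin (1+ m) ⊎ Fin n → Set where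
    bottom : View s₀
    lifted : (x : Fin m ⊎ Fin n) → View (ι x)

  view : (p : Fin (1+ m) ⊎ Fin n) → View p
  view (inj₁ zero)    = bottom
  view (inj₁ (suc a)) = lifted (inj₁ a)
  view (inj₂ c)       = lifted (inj₂ c)

  embed : ∀ {x y} → N x y → M (ι x) (ι y)
  embed {inj₁ _} {inj₁ _} a≡b = inj₁ (cong suc a≡b)
  embed {inj₁ _} {inj₂ _} r   = r
  embed {inj₂ _} {inj₁ _} t   = t
  embed {inj₂ _} {inj₂ _} c≤d = c≤d

  -- ... and reflects it, since s_i ≤ s_j in the star forces i = j for i ≥ 1.
  reflect : ∀ {x y} → M (ι x) (ι y) → N x y
  reflect {inj₁ _} {inj₁ _} (inj₁ sa≡sb) = suc-injective sa≡sb
  reflect {inj₁ _} {inj₁ _} (inj₂ ())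
  reflect {inj₁ _} {inj₂ _} r   = r
  reflect {inj₂ _} {inj₁ _} t   = t
  reflect {inj₂ _} {inj₂ _} c≤d = c≤d

  nothing-below-s₀ : ∀ x → M (ι x) s₀ → ⊥
  nothing-below-s₀ (inj₁ _) (inj₁ ())
  nothing-below-s₀ (inj₁ _) (inj₂ ())
  nothing-below-s₀ (inj₂ _) ()

  -- Being above s₀ is upward closed, provided N is transitive: above a star
  -- element one is above s₀ trivially, and above c ∈ C one inherits the
  -- witness a_i ≤ c from R_o.
  above-s₀ : Transitive N → ∀ {y z} → M s₀ y → M y z → M s₀ z
  above-s₀ _ {_} {inj₁ _} _ _ = inj₂ refl
  above-s₀ _ {inj₁ zero}    {inj₂ _} _ s₀≤c = s₀≤c
  above-s₀ _ {inj₁ (suc a)} {inj₂ _} _ a≤c  = a , a≤c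
  above-s₀ transN {inj₂ _}  {inj₂ _} (a , a≤c) c≤d =
    a , transN {inj₁ a} {inj₂ _} {inj₂ _} a≤c c≤d

  reflexive : Reflexive N → Reflexive M
  reflexive _     {inj₁ _} = inj₁ refl
  reflexive reflN {inj₂ c} = reflN {inj₂ c}

  transitive : Transitive N → Transitive M
  transitive transN {x} {y} {z} x≤y y≤z with view x | view y | view z
  ... | bottom   | _        | _        =
    above-s₀ (λ {i} {j} {k} → transN {i} {j} {k}) {y} {z} x≤y y≤z
  ... | lifted x | bottom   | _        = ⊥-elim (nothing-below-s₀ x x≤y)
  ... | lifted _ | lifted y | bottom   = ⊥-elim (nothing-below-s₀ y y≤z)
  ... | lifted x | lifted y | lifted z =
    embed {x} {z} (transN {x} {y} {z} (reflect {x} {y} x≤y) (reflect {y} {z} y≤z))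

  merging : IsMerging (antichainOrder m) ≤C R T →
            IsMerging (starOrder m) ≤C (Ro m n R) (To m n T)
  merging (reflN , transN) =
    (λ {x} → reflexive (λ {i} → reflN {i}) {x}) ,
    (λ {x} {y} {z} →
       transitive (λ {i} {j} {k} → transN {i} {j} {k}) {x} {y} {z})

  proper : (∀ a c → R a c → T c a → ⊥) →
           ∀ s c → Ro m n R s c → To m n T c s → ⊥
  proper _        zero    _ _ ()
  proper disjoint (suc a) c r t = disjoint a c r t

lemma3p3 : (m n : ℕ) → 1 ≤ m →
    (R : REL (Fin m) (Fin n) 0ℓ) → (T : REL (Fin n) (Fin m) 0ℓ) →
    IsAC• m n R T → IsSC• m n (Ro m n R) (To m n T)
lemma3p3 m n _ R T (isMerging , disjoint) = merging isMerging , proper disjoint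
  where open Coning (chainOrder n) R T
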